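{- Fix a code retrieving function $\rho$ (all triples below are w.r.t. $\rho$). Let $I=\{1,\dots,m\}$ with $m>0$, let $G$ be a reflexive state relation, and assume (1) $P\subseteq\bigcap_{k\in I}P_k$, (2) $R\subseteq\bigcap_{k\in I}R_k$, (3) $\models\{R_k,P_k\}\,p_k\,\{Q_k,\ \bigcap_{l\in I\setminus\{k\}}R_l\cap G\}$ for every $k\in I$, (4) $R_k(Q_k)\subseteq Q_k$ for every $k\in I$, (5) $\bigcap_{k\in I}Q_k\subseteq Q$. Then $\models\{R,P\}\,\Vert(p_1,\dots,p_m)\,\{Q,G\}$.
   Context: Program terms over a state type $\alpha$ are generated by $p::=\mathbf{skip}\mid\mathbf{basic}\,f\mid\mathbf{cjump}\,C\,i\,p\mid\mathbf{while}\,C\,p\,p\mid\mathbf{if}\,C\,p\,p\mid p;p\mid\Vert(p_1,\dots,p_m)\mid\mathbf{await}\,C\,p$ ($f:\alpha\to\alpha$, $C\subseteq\alpha$, $i\in\mathbb N$, $m\ge1$). A code retrieving function $\rho$ maps $\mathbb N$ to terms. The program step relation $\rho\vdash(p,\sigma)\to_{\mathcal P}(p',\sigma')$ is the least relation with: $(\mathbf{basic}\,f,\sigma)\to(\mathbf{skip},f\sigma)$; $(\mathbf{cjump}\,C\,i\,p,\sigma)\to(\rho\,i,\sigma)$ if $\sigma\in C$, $\to(p,\sigma)$ otherwise; $(\mathbf{await}\,C\,p,\sigma)\to(\mathbf{skip},\sigma')$ if $\sigma\in C$ and $(p,\sigma)\to^*(\mathbf{skip},\sigma')$; $(\mathbf{if}\,C\,p_1\,p_2,\sigma)\to(p_1,\sigma)$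 if $\sigma\in C$, $\to(p_2,\sigma)$ otherwise; for $x=\mathbf{while}\,C\,p_1\,p_2$: $(x,\sigma)\to(p_1;(\mathbf{skip};x),\sigma)$ if $\sigma\in C$, $\to(p_2,\sigma)$ otherwise; $(p_1;p_2,\sigma)\to(p_1';p_2,\sigma')$ if $(p_1,\sigma)\to(p_1',\sigma')$; $(\mathbf{skip};p,\sigma)\to(p,\sigma)$; $(\Vert(\dots,p_i,\dots),\sigma)\to(\Vert(\dots,p_i',\dots),\sigma')$ if $(p_i,\sigma)\to(p_i',\sigma')$; $(\Vert(\mathbf{skip},\dots,\mathbf{skip}),\sigma)\to(\mathbf{skip},\sigma)$. A finite potential computation of $(\rho,p)$ is a nonempty finite sequence $(p_0,\sigma_0),\dots,(p_{n-1},\sigma_{n-1})$ with $p_0=p$ where each transition is a program step or an environment step ($p_{i+1}=p_i$, state arbitrary). For a state relation $R$ (subset of $\alpha\times\alpha$), state relation $G$, and state predicates $P,Q\subseteq\alpha$, $\models\{R,P\}\,p\,\{Q,G\}$ means: every finite potential computation of $(\rho,p)$ with $\sigma_0\in P$ and $(\sigma_i,\sigma_{i+1})\in R$ for all environment steps has $(\sigma_i,\sigma_{i+1})\in G$ for all program steps and, if some $p_i=\mathbf{skip}$, $\sigma_i\in Q$ for the least such $i$. $R(X)=\{b\mid\exists a\in X.(a,b)\in R\}$. -}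

module Defs where

open import Data.Nat using (ℕ; zero; suc; _<_)
open import Data.Fin using (Fin)
open import Data.Vec using (Vec; lookup; _[_]≔_)
open import Data.Vec.Relation.Unary.All using (All)
open import Data.Product using (_×_; _,_; proj₁; proj₂)
open import Data.Sum using (_⊎_)
open import Relation.Nullary using (¬_)
open import Relation.Binary.PropositionalEquality using (_≡_; _≢_)
open import Relation.Binary.Construct.Closure.ReflexiveTransitive using (Star)

StPred : Set → Set₁
StPred α = α → Set

StRel : Set → Set₁
StRel α = α → α → Set

-- Program terms.  Parallel composition ‖(p₁,…,p_m) with m ≥ 1 is a
-- vector of length suc n.
data Prog (α : Set) : Set₁ where
  skip  : Prog α
  basic : (α → α) → Prog α
  cjump : StPred α → ℕ → Prog α → Prog α
  while : StPred α → Prog α → Prog α → Prog α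
  if_   : StPred α → Prog α → Prog α → Prog α
  _⨾_   : Prog α → Prog α → Prog α
  par   : ∀ {n} → Vec (Prog α) (suc n) → Prog α
  await : StPred α → Prog α → Prog α

Conf : Set → Set₁
Conf α = Prog α × α

data Step {α : Set} (ρ : ℕ → Prog α) : Conf α → Conf α → Set₁ where
  basicS   : ∀ {f σ} → Step ρ (basic f , σ) (skip , f σ)
  cjumpT   : ∀ {C i p σ} → C σ → Step ρ (cjump C i p , σ) (ρ i , σ)
  cjumpF   : ∀ {C i p σ} → ¬ C σ → Step ρ (cjump C i p , σ) (p , σ)
  awaitS   : ∀ {C p σ σ'} → C σ → Star (Step ρ) (p , σ) (skip , σ') →
             Step ρ (await C p , σ) (skip , σ')
  ifT      : ∀ {C p₁ p₂ σ} → C σ → Step ρ (if_ C p₁ p₂ , σ) (p₁ , σ)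
  ifF      : ∀ {C p₁ p₂ σ} → ¬ C σ → Step ρ (if_ C p₁ p₂ , σ) (p₂ , σ)
  whileT   : ∀ {C p₁ p₂ σ} → C σ →
             Step ρ (while C p₁ p₂ , σ) (p₁ ⨾ (skip ⨾ while C p₁ p₂) , σ)
  whileF   : ∀ {C p₁ p₂ σ} → ¬ C σ → Step ρ (while C p₁ p₂ , σ) (p₂ , σ)
  seqS     : ∀ {p₁ p₁' p₂ σ σ'} → Step ρ (p₁ , σ) (p₁' , σ') →
             Step ρ (p₁ ⨾ p₂ , σ) (p₁' ⨾ p₂ , σ')
  seqSkip  : ∀ {p σ} → Step ρ (skip ⨾ p , σ) (p , σ)
  parS     : ∀ {n} {ps : Vec (Prog α) (suc n)} {p' σ σ'} (i : Fin (suc n)) →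
             Step ρ (lookup ps i , σ) (p' , σ') →
             Step ρ (par ps , σ) (par (ps [ i ]≔ p') , σ')
  parSkip  : ∀ {n} {ps : Vec (Prog α) (suc n)} {σ} →
             All (λ q → q ≡ skip) ps → Step ρ (par ps , σ) (skip , σ)

EnvStep : {α : Set} → Conf α → Conf α → Set₁
EnvStep c c' = proj₁ c' ≡ proj₁ c

-- A finite potential computation of (ρ , p) of length n (n ≥ 1) is given
-- by c : ℕ → Conf α, of which only c 0, …, c (n - 1) matter.
record PotComp {α : Set} (ρ : ℕ → Prog α) (p : Prog α)
               (n : ℕ) (c : ℕ → Conf α) : Set₁ where
  field
    nonempty : 0 < n
    start    : proj₁ (c 0) ≡ p
    trans    : ∀ i → suc i < n → Step ρ (c i) (c (suc i)) ⊎ EnvStep (c i) (c (suc i))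

Valid : {α : Set} → (ℕ → Prog α) → StRel α → StPred α → Prog α →
        StPred α → StRel α → Set₁
Valid {α} ρ R P p Q G =
  ∀ (n : ℕ) (c : ℕ → Conf α) → PotComp ρ p n c →
  P (proj₂ (c 0)) →
  (∀ i → suc i < n → EnvStep (c i) (c (suc i)) →
         R (proj₂ (c i)) (proj₂ (c (suc i)))) →
  (∀ i → suc i < n → Step ρ (c i) (c (suc i)) →
         G (proj₂ (c i)) (proj₂ (c (suc i))))
  × (∀ i → i < n → proj₁ (c i) ≡ skip →
         (∀ j → j < i → proj₁ (c j) ≢ skip) → Q (proj₂ (c i)))

module Submission where

-- Fix a potential computation c of ‖(p₁,…,p_m) that starts in P and whose
-- environment steps satisfy R.  Until it finishes, every configuration is a
-- parallel composition of m threads, so projecting c to its k-th thread gives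
-- a potential computation of p_k: a step of thread i is a program step for
-- thread i and an environment step for every other thread, and an environment
-- step of c is one for every thread.
--
-- The heart of
-- the proof is an induction along c showing that, while c runs, thread k's
-- environment steps satisfy R_k: either they are environment steps of c
-- (R ⊆ R_k), or a step of another thread i, which by validity of p_i and the
-- induction hypothesis lies in its guarantee, contained in R_k.  Validity of
-- the threads then yields the guarantee G for c, and at termination all
-- threads are skip, hence satisfy their (stable) Q_k, whose meet implies Q.

open import Defs
open import Data.Nat using (ℕ; zero; suc; _<_; _≤_; z≤n; s≤s)
open import Data.Nat.Properties using (≤-refl; ≤-trans; n≤1+n; ≤-pred; <⇒≤; m≤n⇒m<n∨m≡n)
open import Data.Fin using (Fin; toℕ) renaming (zero to fzero; suc to fsuc)
open import Data.Fin.Properties using () renaming (_≟_ to _≟ᶠ_)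
open import Data.Vec using (Vec; []; _∷_; lookup; tabulate; _[_]≔_)
open import Data.Vec.Properties using (lookup∘update; lookup∘update′; []≔-lookup; lookup∘tabulate)
open import Data.Vec.Relation.Unary.All.Properties using (lookup⁺)
open import Data.Product using (Σ; _×_; _,_; proj₁; proj₂)
open import Data.Sum using (_⊎_; inj₁; inj₂)
open import Data.Empty using (⊥-elim)
open import Relation.Nullary using (¬_; Dec; yes; no)
open import Relation.Binary.PropositionalEquality
  using (_≡_; _≢_; refl; sym; trans; cong; subst; subst₂)

module _ {α : Set} where

  prog : (ℕ → Conf α) → ℕ → Prog α
  prog c i = proj₁ (c i)

  st : (ℕ → Conf α) → ℕ → α
  st c i = proj₂ (c i)

  RelyUpTo : StRel α → ℕ → (ℕ → Conf α) → Set₁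
  RelyUpTo R L c =
    ∀ i → suc i < L → EnvStep (c i) (c (suc i)) → R (st c i) (st c (suc i))

  rely-shorten : ∀ {R L L' c} → L' ≤ L → RelyUpTo R L c → RelyUpTo R L' c
  rely-shorten L'≤L rely i lt = rely i (≤-trans lt L'≤L)

  rely-extend : ∀ {R j c} → RelyUpTo R (suc j) c →
                (EnvStep (c j) (c (suc j)) → R (st c j) (st c (suc j))) →
                RelyUpTo R (suc (suc j)) c
  rely-extend rely last i lt with m≤n⇒m<n∨m≡n (≤-pred lt)
  ... | inj₁ i<j  = rely i i<j
  ... | inj₂ refl = last

module _ {α : Set} (ρ : ℕ → Prog α) where

  skip-stuck : ∀ {x y} → proj₁ x ≡ skip → ¬ Step ρ x y
  skip-stuck refl ()

  skip? : (p : Prog α) → Dec (p ≡ skip)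
  skip? skip          = yes refl
  skip? (basic _)     = no λ ()
  skip? (cjump _ _ _) = no λ ()
  skip? (while _ _ _) = no λ ()
  skip? (if_ _ _ _)   = no λ ()
  skip? (_ ⨾ _)       = no λ ()
  skip? (par _)       = no λ ()
  skip? (await _ _)   = no λ ()

  module PotentialComputation {p : Prog α} {N : ℕ} {c : ℕ → Conf α}
                              (pc : PotComp ρ p N c) where
    open PotComp pc renaming (trans to transition)

    prefix : ∀ {L} → suc L ≤ N → PotComp ρ p (suc L) c
    prefix L<N = record
      { nonempty = s≤s z≤n
      ; start    = start
      ; trans    = λ i lt → transition i (≤-trans lt L<N) }

    skip-persists : ∀ {a b} → a ≤ b → b < N → prog c a ≡ skip → prog c b ≡ skip
    skip-persists {b = zero} z≤n _ done = done
    skip-persists {b = suc b} a≤b b<N done with m≤n⇒m<n∨m≡n a≤b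
    ... | inj₂ refl = done
    ... | inj₁ (s≤s a≤b') with transition b b<N
    ...   | inj₁ step = ⊥-elim (skip-stuck (skip-persists a≤b' (<⇒≤ b<N) done) step)
    ...   | inj₂ env  = trans env (skip-persists a≤b' (<⇒≤ b<N) done)

    module Consequences {R G : StRel α} {P Q : StPred α}
                        (valid : Valid ρ R P p Q G) (pre : P (st c 0)) where

      valid-guarantee : ∀ {j} → suc j < N → RelyUpTo R (suc (suc j)) c →
                        Step ρ (c j) (c (suc j)) → G (st c j) (st c (suc j))
      valid-guarantee lt rely = proj₁ (valid _ c (prefix lt) pre rely) _ ≤-refl

      -- For an R-stable postcondition, Q holds at every skip configuration,
      -- not only at the first one.
      valid-post : (∀ σ σ' → Q σ → R σ σ' → Q σ') →
                   ∀ {i} → i < N → RelyUpTo R (suc i) c → prog c i ≡ skip → Q (st c i)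
      valid-post stable {zero} lt rely done =
        proj₂ (valid _ c (prefix lt) pre rely) 0 ≤-refl done λ _ ()
      valid-post stable {suc i} lt rely done with skip? (prog c i)
      ... | yes doneᵢ with transition i lt
      ...   | inj₁ step = ⊥-elim (skip-stuck doneᵢ step)
      ...   | inj₂ env  = stable _ _
                (valid-post stable (<⇒≤ lt) (rely-shorten {R = R} {c = c} (n≤1+n _) rely) doneᵢ)
                (rely i ≤-refl env)
      valid-post stable {suc i} lt rely done | no running =
        proj₂ (valid _ c (prefix lt) pre rely) (suc i) ≤-refl done
          λ j j<1+i doneⱼ → running (skip-persists (≤-pred j<1+i) (<⇒≤ lt) doneⱼ)

  -- Entry t of a vector of programs, or skip if there is none.
  entry : ∀ {m} → Vec (Prog α) m → ℕ → Prog α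
  entry []       _       = skip
  entry (p ∷ _)  zero    = p
  entry (_ ∷ ps) (suc t) = entry ps t

  entry-lookup : ∀ {m} (vs : Vec (Prog α) m) (k : Fin m) → entry vs (toℕ k) ≡ lookup vs k
  entry-lookup (_ ∷ _)  fzero    = refl
  entry-lookup (_ ∷ vs) (fsuc k) = entry-lookup vs k

  -- The k-th thread of a parallel composition; skip for any other program
  -- (in particular for a terminated one).
  thread : ∀ {n} → Fin (suc n) → Prog α → Prog α
  thread k (par vs) = entry vs (toℕ k)
  thread k _        = skip

  threadConf : ∀ {n} → Fin (suc n) → Conf α → Conf α
  threadConf k x = thread k (proj₁ x) , proj₂ x

  module Parallel {n : ℕ} where

    thread-par : ∀ k (vs : Vec (Prog α) (suc n)) → thread k (par vs) ≡ lookup vs k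
    thread-par k vs = entry-lookup vs k

    IsPar : Prog α → Set₁
    IsPar p = Σ (Vec (Prog α) (suc n)) λ vs → p ≡ par vs

    par-running : ∀ {p} → IsPar p → p ≢ skip
    par-running (_ , refl) ()

    -- The effect of one program step of a parallel composition on its
    -- threads: either thread i steps (an environment step for the others,
    -- and a stutter of i is a stutter of the whole), or all threads are
    -- skip and the composition terminates without changing the state.
    data ParMove (x y : Conf α) : Set₁ where
      threadMove : (i : Fin (suc n)) →
        Step ρ (threadConf i x) (threadConf i y) →
        (∀ k → k ≢ i → EnvStep (threadConf k x) (threadConf k y)) →
        (EnvStep (threadConf i x) (threadConf i y) → EnvStep x y) →
        IsPar (proj₁ y) → ParMove x y
      finishMove : (∀ (k : Fin (suc n)) → thread k (proj₁ x) ≡ skip) →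
        proj₁ y ≡ skip → proj₂ y ≡ proj₂ x → ParMove x y

    parMove : ∀ {vs : Vec (Prog α) (suc n)} {σ y} → Step ρ (par vs , σ) y → ParMove (par vs , σ) y
    parMove {vs} {σ} (parS {p' = p'} {σ' = σ'} i step) =
      threadMove i own others stutter (_ , refl)
      where
        updated : thread i (par (vs [ i ]≔ p')) ≡ p'
        updated = trans (thread-par i (vs [ i ]≔ p')) (lookup∘update i vs p')

        own : Step ρ (thread i (par vs) , σ) (thread i (par (vs [ i ]≔ p')) , σ')
        own = subst₂ (λ a b → Step ρ (a , σ) (b , σ'))
                     (sym (thread-par i vs)) (sym updated) step

        others : ∀ k → k ≢ i → thread k (par (vs [ i ]≔ p')) ≡ thread k (par vs)
        others k k≢i = trans (thread-par k (vs [ i ]≔ p'))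
                         (trans (lookup∘update′ k≢i vs p') (sym (thread-par k vs)))

        stutter : thread i (par (vs [ i ]≔ p')) ≡ thread i (par vs) →
                  par (vs [ i ]≔ p') ≡ par vs
        stutter same = cong par (trans (cong (vs [ i ]≔_) unchanged) ([]≔-lookup vs i))
          where unchanged : p' ≡ lookup vs i
                unchanged = trans (sym updated) (trans same (thread-par i vs))
    parMove {vs} (parSkip allSkip) =
      finishMove (λ k → trans (thread-par k vs) (lookup⁺ allSkip k)) refl refl

    stepMove : ∀ {x y} → IsPar (proj₁ x) → Step ρ x y → ParMove x y
    stepMove (_ , refl) step = parMove step

    moveShape : ∀ {x y} → ParMove x y → IsPar (proj₁ y) ⊎ proj₁ y ≡ skip
    moveShape (threadMove _ _ _ _ isPar) = inj₁ isPar
    moveShape (finishMove _ done _)      = inj₂ done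

    moveThread : ∀ {x y} (k : Fin (suc n)) → ParMove x y →
                 Step ρ (threadConf k x) (threadConf k y) ⊎ EnvStep (threadConf k x) (threadConf k y)
    moveThread k (threadMove i own others _ _) with k ≟ᶠ i
    ... | yes refl = inj₁ own
    ... | no k≢i   = inj₂ (others k k≢i)
    moveThread k (finishMove threadsDone done _) =
      inj₂ (trans (cong (thread k) done) (sym (threadsDone k)))

  module ParallelComputation {n : ℕ} {ps : Fin (suc n) → Prog α} {N : ℕ} {c : ℕ → Conf α}
                             (pc : PotComp ρ (par (tabulate ps)) N c) where
    open PotComp pc renaming (trans to transition)
    open Parallel {n}

    shape : ∀ j → j < N → IsPar (prog c j) ⊎ prog c j ≡ skip
    shape zero    _  = inj₁ (tabulate ps , start)
    shape (suc j) lt with transition j lt | shape j (<⇒≤ lt)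
    ... | inj₂ env  | shapeⱼ       = subst (λ p → IsPar p ⊎ p ≡ skip) (sym env) shapeⱼ
    ... | inj₁ step | inj₂ done    = ⊥-elim (skip-stuck done step)
    ... | inj₁ step | inj₁ running = moveShape (stepMove running step)

    move : ∀ {j} → suc j < N → Step ρ (c j) (c (suc j)) → ParMove (c j) (c (suc j))
    move lt step with shape _ (<⇒≤ lt)
    ... | inj₁ running = stepMove running step
    ... | inj₂ done    = ⊥-elim (skip-stuck done step)

    threadComp : Fin (suc n) → ℕ → Conf α
    threadComp k j = threadConf k (c j)

    threadPotComp : ∀ k → PotComp ρ (ps k) N (threadComp k)
    threadPotComp k = record
      { nonempty = nonempty
      ; start    = trans (cong (thread k) start)
                         (trans (thread-par k (tabulate ps)) (lookup∘tabulate ps k))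
      ; trans    = threadTransition }
      where
        threadTransition : ∀ j → suc j < N →
          Step ρ (threadComp k j) (threadComp k (suc j)) ⊎ EnvStep (threadComp k j) (threadComp k (suc j))
        threadTransition j lt with transition j lt
        ... | inj₁ step = moveThread k (move lt step)
        ... | inj₂ env  = inj₂ (cong (thread k) env)

module ParallelRule {α : Set} (ρ : ℕ → Prog α) (n : ℕ)
    (R G : StRel α) (P Q : StPred α)
    (Rs : Fin (suc n) → StRel α) (Ps Qs : Fin (suc n) → StPred α)
    (ps : Fin (suc n) → Prog α)
    (G-refl : ∀ σ → G σ σ)
    (P⇒Ps : ∀ σ → P σ → ∀ k → Ps k σ)
    (R⇒Rs : ∀ σ σ' → R σ σ' → ∀ k → Rs k σ σ')
    (threadValid : ∀ k → Valid ρ (Rs k) (Ps k) (ps k) (Qs k)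
                     (λ σ σ' → (∀ l → l ≢ k → Rs l σ σ') × G σ σ'))
    (Qs-stable : ∀ k σ σ' → Qs k σ → Rs k σ σ' → Qs k σ')
    (Qs⇒Q : ∀ σ → (∀ k → Qs k σ) → Q σ)
    {N : ℕ} {c : ℕ → Conf α} (pc : PotComp ρ (par (tabulate ps)) N c)
    (pre : P (st c 0)) (rely : RelyUpTo R N c) where

  open PotComp pc renaming (trans to transition)
  open PotentialComputation ρ pc using (skip-persists)
  open Parallel ρ {n}
  open ParallelComputation ρ {ps = ps} pc

  Running : ℕ → Set₁
  Running j = prog c j ≢ skip

  ThreadGuarantee : Fin (suc n) → StRel α
  ThreadGuarantee k σ σ' = (∀ l → l ≢ k → Rs l σ σ') × G σ σ'

  module ThreadValidity (k : Fin (suc n)) =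
    PotentialComputation.Consequences ρ (threadPotComp k)
      {Rs k} {ThreadGuarantee k} {Ps k} {Qs k} (threadValid k) (P⇒Ps _ pre k)
  open ThreadValidity using (valid-guarantee; valid-post)

  -- A stutter of the stepping thread is a stutter of c, hence
  -- relied on by R; a step of another thread i lies in i's guarantee.
  threadRelyStep : ∀ {j} → suc j < N → Running (suc j) →
                   (∀ k → RelyUpTo (Rs k) (suc j) (threadComp k)) →
                   ∀ k → EnvStep (threadComp k j) (threadComp k (suc j)) →
                   Rs k (st c j) (st c (suc j))
  threadRelyStep {j} lt running relied k env with transition j lt
  ... | inj₂ envᶜ = R⇒Rs _ _ (rely j lt envᶜ) k
  ... | inj₁ step with move lt step
  ... | finishMove _ done _ = ⊥-elim (running done)
  ... | threadMove i own _ stutter _ with k ≟ᶠ i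
  ...   | yes refl = R⇒Rs _ _ (rely j lt (stutter env)) k
  ...   | no k≢i   = proj₁ (valid-guarantee i lt reliedᵢ own) k k≢i
    where
      reliedᵢ : RelyUpTo (Rs i) (suc (suc j)) (threadComp i)
      reliedᵢ = rely-extend {R = Rs i} {c = threadComp i} (relied i)
                  λ envᵢ → R⇒Rs _ _ (rely j lt (stutter envᵢ)) i

  threadRely : ∀ {j} → j < N → Running j → ∀ k → RelyUpTo (Rs k) (suc j) (threadComp k)
  threadRely {zero}  _  _       k i (s≤s ())
  threadRely {suc j} lt running k =
    rely-extend {R = Rs k} {c = threadComp k} (relied k) (threadRelyStep lt running relied k)
    where
      relied : ∀ k → RelyUpTo (Rs k) (suc j) (threadComp k)
      relied = threadRely (<⇒≤ lt) λ done → running (skip-persists (n≤1+n j) lt done)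

  -- Every step of c is a step of some thread (within its guarantee) or the
  -- final step, which leaves the state unchanged.
  guarantee : ∀ j → suc j < N → Step ρ (c j) (c (suc j)) → G (st c j) (st c (suc j))
  guarantee j lt step with move lt step
  ... | threadMove i own _ _ isPar =
        proj₂ (valid-guarantee i lt (threadRely lt (par-running isPar) i) own)
  ... | finishMove _ _ same = subst (G (st c j)) (sym same) (G-refl _)

  -- c terminates by a final step from a configuration where all threads are
  -- skip; each thread's stable postcondition holds there.
  postcondition : ∀ i → i < N → prog c i ≡ skip → (∀ j → j < i → prog c j ≢ skip) → Q (st c i)
  postcondition zero    _  done _ = ⊥-elim (par-running (tabulate ps , start) done)
  postcondition (suc j) lt done first with transition j lt
  ... | inj₂ env  = ⊥-elim (first j ≤-refl (trans (sym env) done))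
  ... | inj₁ step with move lt step
  ... | threadMove _ _ _ _ isPar = ⊥-elim (par-running isPar done)
  ... | finishMove threadsDone _ same = subst Q (sym same) (Qs⇒Q _ threadPost)
    where
      threadPost : ∀ k → Qs k (st c j)
      threadPost k = valid-post k (Qs-stable k) (<⇒≤ lt)
                       (threadRely (<⇒≤ lt) (first j ≤-refl) k) (threadsDone k)

mainTheorem2 : {α : Set} (ρ : ℕ → Prog α) (n : ℕ)
    (R G : StRel α) (P Q : StPred α)
    (Rs : Fin (suc n) → StRel α) (Ps Qs : Fin (suc n) → StPred α)
    (ps : Fin (suc n) → Prog α) →
    (∀ σ → G σ σ) →
    (∀ σ → P σ → ∀ k → Ps k σ) →
    (∀ σ σ' → R σ σ' → ∀ k → Rs k σ σ') →
    (∀ k → Valid ρ (Rs k) (Ps k) (ps k) (Qs k)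
             (λ σ σ' → (∀ l → l ≢ k → Rs l σ σ') × G σ σ')) →
    (∀ k σ σ' → Qs k σ → Rs k σ σ' → Qs k σ') →
    (∀ σ → (∀ k → Qs k σ) → Q σ) →
    Valid ρ R P (par (tabulate ps)) Q G
mainTheorem2 ρ n R G P Q Rs Ps Qs ps G-refl P⇒Ps R⇒Rs threadValid Qs-stable Qs⇒Q
             N c pc pre rely = guarantee , postcondition
  where open ParallelRule ρ n R G P Q Rs Ps Qs ps G-refl P⇒Ps R⇒Rs threadValid Qs-stable Qs⇒Q pc pre rely
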